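{- Let $V$ be a finite set of size $v$ and let $(\mathfrak{P}_0,\ldots,\mathfrak{P}_v)$ be a tactical sequence of partitions on $V$. Let $x,y,z\in\{0,\ldots,v\}$ be integers with $x\leq y\leq z$. Then \[R^{(xy)}\,R^{(yz)}=\binom{z-x}{y-x}R^{(xz)}\qquad\text{and}\qquad K^{(xy)}\,K^{(yz)}=\binom{z-x}{y-x}K^{(xz)}.\]
   Context: For $x\in\{0,\ldots,v\}$, $\binom{V}{x}$ denotes the set of $x$-subsets of $V$, and $\mathfrak{P}_x$ is a partition of $\binom{V}{x}$. The sequence $(\mathfrak{P}_0,\ldots,\mathfrak{P}_v)$ is called a tactical sequence of partitions on $V$ if for all $x\leq y$ and all parts $\mathcal{X}\in\mathfrak{P}_x$, $\mathcal{Y}\in\mathfrak{P}_y$, the number $\#\{Y\in\mathcal{Y}\mid X\subseteq Y\}$ is the same for every $X\in\mathcal{X}$, and the number $\#\{X\in\mathcal{X}\mid X\subseteq Y\}$ is the same for every $Y\in\mathcal{Y}$. These common values define matrices $R^{(xy)},K^{(xy)}\in\mathbb{Z}^{\mathfrak{P}_x\times\mathfrak{P}_y}$ with $R^{(xy)}_{\mathcal{X},\mathcal{Y}}=\#\{Y\in\mathcal{Y}\mid X\subseteq Y\}$ (any $X\in\mathcal{X}$) and $K^{(xy)}_{\mathcal{X},\mathcal{Y}}=\#\{X\in\mathcal{X}\mid X\subseteq Y\}$ (any $Y\in\mathcal{Y}$). -}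

module Defs where

open import Data.Nat using (ℕ; zero; suc; _+_; _*_; _≤_; _<_; _≟_)
open import Data.Nat.Combinatorics using (_C_)
open import Data.Fin using (Fin; toℕ)
open import Data.Fin.Subset using (Subset; ∣_∣; _⊆_; inside; outside)
open import Data.Fin.Subset.Properties using (_⊆?_)
open import Data.List using (List; []; _∷_; _++_; map; filter; length)
open import Data.Vec using (Vec; []; _∷_)
import Data.Vec as Vec
open import Data.Product using (Σ; ∃; _×_; _,_)
open import Relation.Nullary using (Dec)
open import Relation.Nullary.Decidable using (_×-dec_)
open import Relation.Unary using (Pred; Decidable)
open import Relation.Binary.PropositionalEquality using (_≡_)
open import Level using (0ℓ)

allSubsets : (v : ℕ) → List (Subset v)
allSubsets zero = [] ∷ []
allSubsets (suc v) = map (outside ∷_) (allSubsets v) ++ map (inside ∷_) (allSubsets v)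

count : {v : ℕ} (P : Pred (Subset v) 0ℓ) → Decidable P → ℕ
count {v} P P? = length (filter P? (allSubsets v))

∑ : (n : ℕ) → (Fin n → ℕ) → ℕ
∑ n f = Vec.sum (Vec.tabulate f)

-- A family of partitions 𝔓_x of the x-subsets of V, x = 0..v.
-- The partition 𝔓_x has  nParts x  parts, indexed by Fin (nParts x);
-- a subset S lies in part number  cls S  of the partition 𝔓_{∣S∣}.
record PartitionSeq (v : ℕ) : Set where
  field
    nParts   : ℕ → ℕ
    cls      : Subset v → ℕ
    cls<     : (S : Subset v) → cls S < nParts ∣ S ∣
    nonempty : (x : ℕ) → x ≤ v → (j : Fin (nParts x)) →
               ∃ λ (S : Subset v) → ∣ S ∣ ≡ x × cls S ≡ toℕ j

  InPart : (x : ℕ) → Fin (nParts x) → Subset v → Set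
  InPart x j S = ∣ S ∣ ≡ x × cls S ≡ toℕ j

  InPart? : (x : ℕ) (j : Fin (nParts x)) → Decidable (InPart x j)
  InPart? x j S = (∣ S ∣ ≟ x) ×-dec (cls S ≟ toℕ j)

  upCount : (y : ℕ) → Fin (nParts y) → Subset v → ℕ
  upCount y j X = count (λ Y → InPart y j Y × X ⊆ Y) (λ Y → InPart? y j Y ×-dec (X ⊆? Y))

  downCount : (x : ℕ) → Fin (nParts x) → Subset v → ℕ
  downCount x i Y = count (λ X → InPart x i X × X ⊆ Y) (λ X → InPart? x i X ×-dec (X ⊆? Y))

record Tactical {v : ℕ} (𝔓 : PartitionSeq v) : Set where
  open PartitionSeq 𝔓
  field
    R : (x y : ℕ) → Fin (nParts x) → Fin (nParts y) → ℕ
    K : (x y : ℕ) → Fin (nParts x) → Fin (nParts y) → ℕ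
    R-spec : (x y : ℕ) → x ≤ y → y ≤ v → (i : Fin (nParts x)) (j : Fin (nParts y)) →
             (X : Subset v) → InPart x i X → upCount y j X ≡ R x y i j
    K-spec : (x y : ℕ) → x ≤ y → y ≤ v → (i : Fin (nParts x)) (j : Fin (nParts y)) →
             (Y : Subset v) → InPart y j Y → downCount x i Y ≡ K x y i j

-- Double counting.  Fix X in the part 𝒳 of 𝔓_x.  Grouping the sets Y of size y by
-- their part 𝒴 of 𝔓_y, the sum ∑_𝒴 R^{(xy)}_{𝒳𝒴} R^{(yz)}_{𝒴𝒵} counts the chains
-- X ⊆ Y ⊆ Z with ∣Y∣ = y and Z ∈ 𝒵.  Counting them by Z instead, each Z ∈ 𝒵 above X
-- lies over exactly C(z − x, y − x) such Y, which gives C(z − x, y − x) R^{(xz)}_{𝒳𝒵}.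
-- The identity for K is the same count with a fixed Z ∈ 𝒵, grouped by the part of Y.
module Submission where

open import Defs
import Algebra.Properties.CommutativeSemigroup as CommutativeSemigroupProperties
open import Data.Bool using (Bool; if_then_else_)
open import Data.Empty using (⊥-elim)
open import Data.Fin as Fin using (Fin; toℕ)
open import Data.Fin.Subset using (Subset; ∣_∣; _⊆_; inside; outside)
open import Data.Fin.Subset.Properties using (_⊆?_; ⊆-trans; drop-∷-⊆; p⊆q⇒∣p∣≤∣q∣)
open import Data.List using (List; []; _∷_; _++_; map; filter; length; tabulate; allFin)
open import Data.Nat using (ℕ; zero; suc; _+_; _*_; _∸_; _≤_; _<_; _≟_; s≤s)
open import Data.Nat.Combinatorics using (_C_; nCk+nC[k+1]≡[n+1]C[k+1])
open import Data.Nat.Properties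
open import Data.Product using (_×_; _,_)
open import Data.Vec using ([]; _∷_; here)
open import Function using (_∘_; id)
open import Level using (Level; 0ℓ)
open import Relation.Nullary using (Dec; yes; no; does; ¬_)
open import Relation.Nullary.Decidable using (_×-dec_)
open import Relation.Unary using (Pred; Decidable)
open import Relation.Binary.PropositionalEquality

open CommutativeSemigroupProperties +-commutativeSemigroup using (interchange)
open CommutativeSemigroupProperties *-commutativeSemigroup using (x∙yz≈y∙xz; xy∙z≈xz∙y)

private
  variable
    ℓ : Level
    A B : Set
    v : ℕ

𝟙 : {P : Set ℓ} → Dec P → ℕ
𝟙 p = if does p then 1 else 0

𝟙-× : {P Q : Set} (p : Dec P) (q : Dec Q) → 𝟙 (p ×-dec q) ≡ 𝟙 p * 𝟙 q
𝟙-× (yes _) q = sym (+-identityʳ (𝟙 q))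
𝟙-× (no _)  q = refl

𝟙-no : {P : Set ℓ} (p : Dec P) → ¬ P → 𝟙 p ≡ 0
𝟙-no (yes p) ¬p = ⊥-elim (¬p p)
𝟙-no (no _)  _  = refl

𝟙-*-cong : {P : Set ℓ} (p : Dec P) {m n : ℕ} → (P → m ≡ n) → 𝟙 p * m ≡ 𝟙 p * n
𝟙-*-cong (yes p) m≡n = cong (1 *_) (m≡n p)
𝟙-*-cong (no _)  m≡n = refl

∑ₗ : List A → (A → ℕ) → ℕ
∑ₗ []      f = 0
∑ₗ (a ∷ L) f = f a + ∑ₗ L f

∑ₗ-cong : (L : List A) {f g : A → ℕ} → f ≗ g → ∑ₗ L f ≡ ∑ₗ L g
∑ₗ-cong []      f≗g = refl
∑ₗ-cong (a ∷ L) f≗g = cong₂ _+_ (f≗g a) (∑ₗ-cong L f≗g)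

∑ₗ-zero : (L : List A) {f : A → ℕ} → (∀ a → f a ≡ 0) → ∑ₗ L f ≡ 0
∑ₗ-zero []      f≡0 = refl
∑ₗ-zero (a ∷ L) f≡0 = cong₂ _+_ (f≡0 a) (∑ₗ-zero L f≡0)

∑ₗ-++ : (L M : List A) (f : A → ℕ) → ∑ₗ (L ++ M) f ≡ ∑ₗ L f + ∑ₗ M f
∑ₗ-++ []      M f = refl
∑ₗ-++ (a ∷ L) M f = trans (cong (f a +_) (∑ₗ-++ L M f)) (sym (+-assoc (f a) _ _))

∑ₗ-map : (g : A → B) (L : List A) (f : B → ℕ) → ∑ₗ (map g L) f ≡ ∑ₗ L (f ∘ g)
∑ₗ-map g []      f = refl
∑ₗ-map g (a ∷ L) f = cong (f (g a) +_) (∑ₗ-map g L f)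

∑ₗ-+ : (L : List A) (f g : A → ℕ) → ∑ₗ L (λ a → f a + g a) ≡ ∑ₗ L f + ∑ₗ L g
∑ₗ-+ []      f g = refl
∑ₗ-+ (a ∷ L) f g = trans (cong (f a + g a +_) (∑ₗ-+ L f g)) (interchange (f a) (g a) _ _)

∑ₗ-*ˡ : (L : List A) (f : A → ℕ) (c : ℕ) → c * ∑ₗ L f ≡ ∑ₗ L (λ a → c * f a)
∑ₗ-*ˡ []      f c = *-zeroʳ c
∑ₗ-*ˡ (a ∷ L) f c = trans (*-distribˡ-+ c (f a) _) (cong (c * f a +_) (∑ₗ-*ˡ L f c))

∑ₗ-*ʳ : (L : List A) (f : A → ℕ) (c : ℕ) → ∑ₗ L f * c ≡ ∑ₗ L (λ a → f a * c)
∑ₗ-*ʳ []      f c = refl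
∑ₗ-*ʳ (a ∷ L) f c = trans (*-distribʳ-+ c (f a) _) (cong (f a * c +_) (∑ₗ-*ʳ L f c))

∑ₗ-comm : (L : List A) (M : List B) (f : A → B → ℕ) →
  ∑ₗ L (λ a → ∑ₗ M (f a)) ≡ ∑ₗ M (λ b → ∑ₗ L (λ a → f a b))
∑ₗ-comm []      M f = sym (∑ₗ-zero M (λ _ → refl))
∑ₗ-comm (a ∷ L) M f = trans (cong (∑ₗ M (f a) +_) (∑ₗ-comm L M f)) (sym (∑ₗ-+ M (f a) _))

∑ₗ-exchange : (L : List A) (M : List B) (g : A → ℕ) (h : B → ℕ) (k : A → B → ℕ) →
  ∑ₗ L (λ a → g a * ∑ₗ M (λ b → h b * k a b))
    ≡ ∑ₗ M (λ b → h b * ∑ₗ L (λ a → g a * k a b))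
∑ₗ-exchange L M g h k = begin
  ∑ₗ L (λ a → g a * ∑ₗ M (λ b → h b * k a b))
    ≡⟨ ∑ₗ-cong L (λ a → ∑ₗ-*ˡ M _ (g a)) ⟩
  ∑ₗ L (λ a → ∑ₗ M (λ b → g a * (h b * k a b)))
    ≡⟨ ∑ₗ-cong L (λ a → ∑ₗ-cong M (λ b → x∙yz≈y∙xz (g a) (h b) (k a b))) ⟩
  ∑ₗ L (λ a → ∑ₗ M (λ b → h b * (g a * k a b)))
    ≡⟨ ∑ₗ-comm L M _ ⟩
  ∑ₗ M (λ b → ∑ₗ L (λ a → h b * (g a * k a b)))
    ≡⟨ ∑ₗ-cong M (λ b → ∑ₗ-*ˡ L _ (h b)) ⟨
  ∑ₗ M (λ b → h b * ∑ₗ L (λ a → g a * k a b)) ∎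
  where open ≡-Reasoning

∑ₗ-𝟙-*ʳ : (L : List A) {P : Pred A ℓ} (P? : Decidable P) {f g : A → ℕ} {c : ℕ} →
  (∀ a → P a → f a ≡ g a * c) →
  ∑ₗ L (λ a → 𝟙 (P? a) * f a) ≡ ∑ₗ L (λ a → 𝟙 (P? a) * g a) * c
∑ₗ-𝟙-*ʳ L P? {c = c} f≡gc = trans
  (∑ₗ-cong L (λ a → trans (𝟙-*-cong (P? a) (f≡gc a)) (sym (*-assoc (𝟙 (P? a)) _ c))))
  (sym (∑ₗ-*ʳ L _ c))

length-filter≡∑ₗ𝟙 : {P : Pred A ℓ} (P? : Decidable P) (L : List A) →
  length (filter P? L) ≡ ∑ₗ L (𝟙 ∘ P?)
length-filter≡∑ₗ𝟙 P? []      = refl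
length-filter≡∑ₗ𝟙 P? (a ∷ L) with P? a
... | yes _ = cong suc (length-filter≡∑ₗ𝟙 P? L)
... | no _  = length-filter≡∑ₗ𝟙 P? L

∑ₗ-tabulate : ∀ n (g : Fin n → A) (f : A → ℕ) → ∑ₗ (tabulate g) f ≡ ∑ n (f ∘ g)
∑ₗ-tabulate zero    g f = refl
∑ₗ-tabulate (suc n) g f = cong (f (g Fin.zero) +_) (∑ₗ-tabulate n (g ∘ Fin.suc) f)

∑≡∑ₗ-allFin : ∀ n (f : Fin n → ℕ) → ∑ n f ≡ ∑ₗ (allFin n) f
∑≡∑ₗ-allFin n f = sym (∑ₗ-tabulate n id f)

∑-cong : ∀ n {f g : Fin n → ℕ} → f ≗ g → ∑ n f ≡ ∑ n g
∑-cong n {f} {g} f≗g =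
  trans (∑≡∑ₗ-allFin n f) (trans (∑ₗ-cong (allFin n) f≗g) (sym (∑≡∑ₗ-allFin n g)))

∑-*ˡ : ∀ n (f : Fin n → ℕ) c → c * ∑ n f ≡ ∑ n (λ j → c * f j)
∑-*ˡ n f c =
  trans (cong (c *_) (∑≡∑ₗ-allFin n f)) (trans (∑ₗ-*ˡ (allFin n) f c) (sym (∑≡∑ₗ-allFin n _)))

∑-*ʳ : ∀ n (f : Fin n → ℕ) c → ∑ n f * c ≡ ∑ n (λ j → f j * c)
∑-*ʳ n f c =
  trans (cong (_* c) (∑≡∑ₗ-allFin n f)) (trans (∑ₗ-*ʳ (allFin n) f c) (sym (∑≡∑ₗ-allFin n _)))

∑-∑ₗ-comm : ∀ n (L : List A) (f : Fin n → A → ℕ) →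
  ∑ n (λ j → ∑ₗ L (f j)) ≡ ∑ₗ L (λ a → ∑ n (λ j → f j a))
∑-∑ₗ-comm n L f = trans (∑≡∑ₗ-allFin n _)
  (trans (∑ₗ-comm (allFin n) L f) (∑ₗ-cong L (λ a → sym (∑≡∑ₗ-allFin n _))))

∑-𝟙-≟-toℕ : ∀ n c → c < n → ∑ n (λ j → 𝟙 (c ≟ toℕ j)) ≡ 1
∑-𝟙-≟-toℕ (suc n) zero    _         =
  cong suc (trans (∑≡∑ₗ-allFin n _) (∑ₗ-zero (allFin n) (λ _ → refl)))
∑-𝟙-≟-toℕ (suc n) (suc c) (s≤s c<n) = ∑-𝟙-≟-toℕ n c c<n

∑ˢ : (Subset v → ℕ) → ℕ
∑ˢ {v} = ∑ₗ (allSubsets v)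

∑ˢ-suc : (f : Subset (suc v) → ℕ) → ∑ˢ f ≡ ∑ˢ (f ∘ (outside ∷_)) + ∑ˢ (f ∘ (inside ∷_))
∑ˢ-suc {v} f = trans (∑ₗ-++ (map (outside ∷_) (allSubsets v)) _ f)
  (cong₂ _+_ (∑ₗ-map _ (allSubsets v) f) (∑ₗ-map _ (allSubsets v) f))

count≡∑ˢ𝟙 : {P : Pred (Subset v) 0ℓ} (P? : Decidable P) → count P P? ≡ ∑ˢ (𝟙 ∘ P?)
count≡∑ˢ𝟙 {v} P? = length-filter≡∑ₗ𝟙 P? (allSubsets v)

intervalCount : Subset v → ℕ → Subset v → ℕ
intervalCount X n Z = ∑ˢ (λ Y → (𝟙 (∣ Y ∣ ≟ n) * 𝟙 (X ⊆? Y)) * 𝟙 (Y ⊆? Z))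

-- Once s and t are fixed, ∣_∣ and _⊆?_ compute on the head bits, so each half reduces
-- either to an interval count in Subset v or to a sum of zeros.
intervalCount-∷ : (X Z : Subset v) (s t : Bool) (n : ℕ) →
  intervalCount (s ∷ X) n (t ∷ Z)
    ≡ ∑ˢ (λ Y → (𝟙 (∣ outside ∷ Y ∣ ≟ n) * 𝟙 (s ∷ X ⊆? outside ∷ Y)) * 𝟙 (outside ∷ Y ⊆? t ∷ Z))
      + ∑ˢ (λ Y → (𝟙 (∣ inside ∷ Y ∣ ≟ n) * 𝟙 (s ∷ X ⊆? inside ∷ Y)) * 𝟙 (inside ∷ Y ⊆? t ∷ Z))
intervalCount-∷ X Z s t n =
  ∑ˢ-suc (λ Y → (𝟙 (∣ Y ∣ ≟ n) * 𝟙 (s ∷ X ⊆? Y)) * 𝟙 (Y ⊆? t ∷ Z))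

intervalCount-binomial : (X Z : Subset v) → X ⊆ Z → ∀ m d → ∣ Z ∣ ≡ ∣ X ∣ + d →
  intervalCount X (∣ X ∣ + m) Z ≡ d C m
intervalCount-binomial []            []            _   zero    .0 refl = refl
intervalCount-binomial []            []            _   (suc m) .0 refl = refl
intervalCount-binomial {suc v} (outside ∷ X) (outside ∷ Z) X⊆Z m d ∣Z∣≡∣X∣+d = begin
  intervalCount (outside ∷ X) (∣ X ∣ + m) (outside ∷ Z)
    ≡⟨ intervalCount-∷ X Z outside outside (∣ X ∣ + m) ⟩
  intervalCount X (∣ X ∣ + m) Z + ∑ˢ (λ Y → (𝟙 (suc ∣ Y ∣ ≟ ∣ X ∣ + m) * 𝟙 (X ⊆? Y)) * 0)
    ≡⟨ cong (intervalCount X (∣ X ∣ + m) Z +_)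
         (∑ₗ-zero (allSubsets v) (λ Y → *-zeroʳ (𝟙 (suc ∣ Y ∣ ≟ ∣ X ∣ + m) * 𝟙 (X ⊆? Y)))) ⟩
  intervalCount X (∣ X ∣ + m) Z + 0
    ≡⟨ +-identityʳ _ ⟩
  intervalCount X (∣ X ∣ + m) Z
    ≡⟨ intervalCount-binomial X Z (drop-∷-⊆ X⊆Z) m d ∣Z∣≡∣X∣+d ⟩
  d C m ∎
  where open ≡-Reasoning
intervalCount-binomial {suc v} (inside ∷ X)  (inside ∷ Z)  X⊆Z m d ∣Z∣≡∣X∣+d = begin
  intervalCount (inside ∷ X) (suc ∣ X ∣ + m) (inside ∷ Z)
    ≡⟨ intervalCount-∷ X Z inside inside (suc ∣ X ∣ + m) ⟩
  ∑ˢ (λ Y → (𝟙 (∣ Y ∣ ≟ suc (∣ X ∣ + m)) * 0) * 𝟙 (Y ⊆? Z)) + intervalCount X (∣ X ∣ + m) Z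
    ≡⟨ cong (_+ intervalCount X (∣ X ∣ + m) Z) (∑ₗ-zero (allSubsets v) (λ Y →
         cong (_* 𝟙 (Y ⊆? Z)) (*-zeroʳ (𝟙 (∣ Y ∣ ≟ suc (∣ X ∣ + m)))))) ⟩
  intervalCount X (∣ X ∣ + m) Z
    ≡⟨ intervalCount-binomial X Z (drop-∷-⊆ X⊆Z) m d (suc-injective ∣Z∣≡∣X∣+d) ⟩
  d C m ∎
  where open ≡-Reasoning
intervalCount-binomial (inside ∷ X)  (outside ∷ Z) X⊆Z m d _ with () ← X⊆Z here
intervalCount-binomial (outside ∷ X) (inside ∷ Z)  X⊆Z m zero ∣Z∣≡∣X∣+0 =
  ⊥-elim (1+n≰n (≤-trans (≤-reflexive (trans ∣Z∣≡∣X∣+0 (+-identityʳ _)))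
                         (p⊆q⇒∣p∣≤∣q∣ (drop-∷-⊆ X⊆Z))))
intervalCount-binomial {suc v} (outside ∷ X) (inside ∷ Z)  X⊆Z zero (suc d) ∣Z∣≡∣X∣+d = begin
  intervalCount (outside ∷ X) (∣ X ∣ + 0) (inside ∷ Z)
    ≡⟨ intervalCount-∷ X Z outside inside (∣ X ∣ + 0) ⟩
  intervalCount X (∣ X ∣ + 0) Z
    + ∑ˢ (λ Y → (𝟙 (suc ∣ Y ∣ ≟ ∣ X ∣ + 0) * 𝟙 (X ⊆? Y)) * 𝟙 (Y ⊆? Z))
    ≡⟨ cong₂ _+_ (intervalCount-binomial X Z X⊆Z′ zero d ∣Z∣≡∣X∣+d′)
                 (∑ₗ-zero (allSubsets v) tooSmall) ⟩
  d C 0 + 0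
    ≡⟨ +-identityʳ _ ⟩
  d C 0
    ≡⟨⟩
  suc d C 0 ∎
  where
  open ≡-Reasoning
  X⊆Z′ = drop-∷-⊆ X⊆Z
  ∣Z∣≡∣X∣+d′ = suc-injective (trans ∣Z∣≡∣X∣+d (+-suc _ d))
  tooSmall : ∀ Y → (𝟙 (suc ∣ Y ∣ ≟ ∣ X ∣ + 0) * 𝟙 (X ⊆? Y)) * 𝟙 (Y ⊆? Z) ≡ 0
  tooSmall Y with X ⊆? Y
  ... | no _    = cong (_* 𝟙 (Y ⊆? Z)) (*-zeroʳ (𝟙 (suc ∣ Y ∣ ≟ ∣ X ∣ + 0)))
  ... | yes X⊆Y = cong (λ t → (t * 1) * 𝟙 (Y ⊆? Z)) (𝟙-no (suc ∣ Y ∣ ≟ _) (λ ∣Y∣<∣X∣ →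
    1+n≰n (≤-trans (≤-reflexive (trans ∣Y∣<∣X∣ (+-identityʳ _)))
                   (p⊆q⇒∣p∣≤∣q∣ X⊆Y))))
intervalCount-binomial {suc v} (outside ∷ X) (inside ∷ Z)  X⊆Z (suc m) (suc d) ∣Z∣≡∣X∣+d = begin
  intervalCount (outside ∷ X) (∣ X ∣ + suc m) (inside ∷ Z)
    ≡⟨ intervalCount-∷ X Z outside inside (∣ X ∣ + suc m) ⟩
  intervalCount X (∣ X ∣ + suc m) Z
    + ∑ˢ (λ Y → (𝟙 (suc ∣ Y ∣ ≟ ∣ X ∣ + suc m) * 𝟙 (X ⊆? Y)) * 𝟙 (Y ⊆? Z))
    ≡⟨ cong (λ n → intervalCount X (∣ X ∣ + suc m) Z
                     + ∑ˢ (λ Y → (𝟙 (suc ∣ Y ∣ ≟ n) * 𝟙 (X ⊆? Y)) * 𝟙 (Y ⊆? Z)))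
            (+-suc ∣ X ∣ m) ⟩
  intervalCount X (∣ X ∣ + suc m) Z + intervalCount X (∣ X ∣ + m) Z
    ≡⟨ cong₂ _+_ (intervalCount-binomial X Z X⊆Z′ (suc m) d ∣Z∣≡∣X∣+d′)
                 (intervalCount-binomial X Z X⊆Z′ m d ∣Z∣≡∣X∣+d′) ⟩
  d C suc m + d C m
    ≡⟨ +-comm (d C suc m) _ ⟩
  d C m + d C suc m
    ≡⟨ nCk+nC[k+1]≡[n+1]C[k+1] d m ⟩
  suc d C suc m ∎
  where
  open ≡-Reasoning
  X⊆Z′ = drop-∷-⊆ X⊆Z
  ∣Z∣≡∣X∣+d′ = suc-injective (trans ∣Z∣≡∣X∣+d (+-suc _ d))

intervalCount≡𝟙*C : (X Z : Subset v) {x y z : ℕ} →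
  ∣ X ∣ ≡ x → ∣ Z ∣ ≡ z → x ≤ y → y ≤ z →
  intervalCount X y Z ≡ 𝟙 (X ⊆? Z) * ((z ∸ x) C (y ∸ x))
intervalCount≡𝟙*C X Z {y = y} refl refl x≤y y≤z with X ⊆? Z
... | yes X⊆Z = begin
  intervalCount X y Z
    ≡⟨ cong (λ n → intervalCount X n Z) (m+[n∸m]≡n x≤y) ⟨
  intervalCount X (∣ X ∣ + (y ∸ ∣ X ∣)) Z
    ≡⟨ intervalCount-binomial X Z X⊆Z _ _ (sym (m+[n∸m]≡n (≤-trans x≤y y≤z))) ⟩
  (∣ Z ∣ ∸ ∣ X ∣) C (y ∸ ∣ X ∣)
    ≡⟨ +-identityʳ _ ⟨
  1 * ((∣ Z ∣ ∸ ∣ X ∣) C (y ∸ ∣ X ∣)) ∎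
  where open ≡-Reasoning
... | no X⊈Z = ∑ₗ-zero (allSubsets _) noChain
  where
  noChain : ∀ Y → (𝟙 (∣ Y ∣ ≟ y) * 𝟙 (X ⊆? Y)) * 𝟙 (Y ⊆? Z) ≡ 0
  noChain Y with X ⊆? Y | Y ⊆? Z
  ... | yes X⊆Y | yes Y⊆Z = ⊥-elim (X⊈Z (⊆-trans X⊆Y Y⊆Z))
  ... | yes _   | no _    = *-zeroʳ (𝟙 (∣ Y ∣ ≟ y) * 1)
  ... | no _    | Y⊆?Z    = cong (_* 𝟙 Y⊆?Z) (*-zeroʳ (𝟙 (∣ Y ∣ ≟ y)))

module _ (𝔓 : PartitionSeq v) where
  open PartitionSeq 𝔓

  upCount≡∑ˢ : ∀ y j (X : Subset v) →
    upCount y j X ≡ ∑ˢ (λ Y → 𝟙 (InPart? y j Y) * 𝟙 (X ⊆? Y))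
  upCount≡∑ˢ y j X = trans (count≡∑ˢ𝟙 (λ Y → InPart? y j Y ×-dec (X ⊆? Y)))
    (∑ₗ-cong (allSubsets v) (λ Y → 𝟙-× (InPart? y j Y) (X ⊆? Y)))

  downCount≡∑ˢ : ∀ x i (Y : Subset v) →
    downCount x i Y ≡ ∑ˢ (λ X → 𝟙 (InPart? x i X) * 𝟙 (X ⊆? Y))
  downCount≡∑ˢ x i Y = trans (count≡∑ˢ𝟙 (λ X → InPart? x i X ×-dec (X ⊆? Y)))
    (∑ₗ-cong (allSubsets v) (λ X → 𝟙-× (InPart? x i X) (X ⊆? Y)))

  ∑-𝟙-InPart : ∀ y (Y : Subset v) →
    ∑ (nParts y) (λ j → 𝟙 (InPart? y j Y)) ≡ 𝟙 (∣ Y ∣ ≟ y)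
  ∑-𝟙-InPart y Y = begin
    ∑ (nParts y) (λ j → 𝟙 (InPart? y j Y))
      ≡⟨ ∑-cong (nParts y) (λ j → 𝟙-× (∣ Y ∣ ≟ y) (cls Y ≟ toℕ j)) ⟩
    ∑ (nParts y) (λ j → 𝟙 (∣ Y ∣ ≟ y) * 𝟙 (cls Y ≟ toℕ j))
      ≡⟨ ∑-*ˡ (nParts y) _ (𝟙 (∣ Y ∣ ≟ y)) ⟨
    𝟙 (∣ Y ∣ ≟ y) * ∑ (nParts y) (λ j → 𝟙 (cls Y ≟ toℕ j))
      ≡⟨ 𝟙-*-cong (∣ Y ∣ ≟ y) (λ { refl → ∑-𝟙-≟-toℕ (nParts ∣ Y ∣) (cls Y) (cls< Y) }) ⟩
    𝟙 (∣ Y ∣ ≟ y) * 1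
      ≡⟨ *-identityʳ _ ⟩
    𝟙 (∣ Y ∣ ≟ y) ∎
    where open ≡-Reasoning

  ∑-over-parts : ∀ y (M : Fin (nParts y) → ℕ) (f w : Subset v → ℕ) →
    (∀ j Y → InPart y j Y → f Y ≡ M j) →
    ∑ (nParts y) (λ j → ∑ˢ (λ Y → 𝟙 (InPart? y j Y) * w Y) * M j)
      ≡ ∑ˢ (λ Y → (𝟙 (∣ Y ∣ ≟ y) * w Y) * f Y)
  ∑-over-parts y M f w f≡M = begin
    ∑ n (λ j → ∑ˢ (λ Y → 𝟙 (InPart? y j Y) * w Y) * M j)
      ≡⟨ ∑-cong n (λ j → trans (∑ₗ-*ʳ (allSubsets v) _ (M j))
                                (∑ₗ-cong (allSubsets v) (constantOnParts j))) ⟩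
    ∑ n (λ j → ∑ˢ (λ Y → 𝟙 (InPart? y j Y) * (w Y * f Y)))
      ≡⟨ ∑-∑ₗ-comm n (allSubsets v) _ ⟩
    ∑ˢ (λ Y → ∑ n (λ j → 𝟙 (InPart? y j Y) * (w Y * f Y)))
      ≡⟨ ∑ₗ-cong (allSubsets v) (λ Y → trans (sym (∑-*ʳ n _ (w Y * f Y)))
                                             (cong (_* (w Y * f Y)) (∑-𝟙-InPart y Y))) ⟩
    ∑ˢ (λ Y → 𝟙 (∣ Y ∣ ≟ y) * (w Y * f Y))
      ≡⟨ ∑ₗ-cong (allSubsets v) (λ Y → *-assoc (𝟙 (∣ Y ∣ ≟ y)) (w Y) (f Y)) ⟨
    ∑ˢ (λ Y → (𝟙 (∣ Y ∣ ≟ y) * w Y) * f Y) ∎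
    where
    open ≡-Reasoning
    n = nParts y
    constantOnParts : ∀ j Y →
      (𝟙 (InPart? y j Y) * w Y) * M j ≡ 𝟙 (InPart? y j Y) * (w Y * f Y)
    constantOnParts j Y = trans (*-assoc (𝟙 (InPart? y j Y)) (w Y) (M j))
      (𝟙-*-cong (InPart? y j Y) (λ Y∈j → cong (w Y *_) (sym (f≡M j Y Y∈j))))

module _ {𝔓 : PartitionSeq v} (T : Tactical 𝔓) where
  open PartitionSeq 𝔓
  open Tactical T

  R≡∑ˢ : ∀ {x y} → x ≤ y → y ≤ v → ∀ i j {X} → InPart x i X →
    R x y i j ≡ ∑ˢ (λ Y → 𝟙 (InPart? y j Y) * 𝟙 (X ⊆? Y))
  R≡∑ˢ x≤y y≤v i j {X} X∈i =
    trans (sym (R-spec _ _ x≤y y≤v i j X X∈i)) (upCount≡∑ˢ 𝔓 _ j X)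

  K≡∑ˢ : ∀ {x y} → x ≤ y → y ≤ v → ∀ i j {Y} → InPart y j Y →
    K x y i j ≡ ∑ˢ (λ X → 𝟙 (InPart? x i X) * 𝟙 (X ⊆? Y))
  K≡∑ˢ x≤y y≤v i j {Y} Y∈j =
    trans (sym (K-spec _ _ x≤y y≤v i j Y Y∈j)) (downCount≡∑ˢ 𝔓 _ i Y)

  module _ {x y z : ℕ} (x≤y : x ≤ y) (y≤z : y ≤ z) (z≤v : z ≤ v) where
    private
      y≤v = ≤-trans y≤z z≤v
      x≤z = ≤-trans x≤y y≤z
      c = (z ∸ x) C (y ∸ x)

    R-product : ∀ i k → ∑ (nParts y) (λ j → R x y i j * R y z j k) ≡ c * R x z i k
    R-product i k with nonempty x (≤-trans x≤y y≤v) i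
    ... | X , X∈i@(∣X∣≡x , _) = begin
      ∑ (nParts y) (λ j → R x y i j * R y z j k)
        ≡⟨ ∑-cong (nParts y) (λ j → cong (_* R y z j k) (R≡∑ˢ x≤y y≤v i j X∈i)) ⟩
      ∑ (nParts y) (λ j → ∑ˢ (λ Y → 𝟙 (InPart? y j Y) * 𝟙 (X ⊆? Y)) * R y z j k)
        ≡⟨ ∑-over-parts 𝔓 y (λ j → R y z j k) above (λ Y → 𝟙 (X ⊆? Y))
             (λ j Y Y∈j → sym (R≡∑ˢ y≤z z≤v j k Y∈j)) ⟩
      ∑ˢ (λ Y → (𝟙 (∣ Y ∣ ≟ y) * 𝟙 (X ⊆? Y)) * above Y)
        ≡⟨ ∑ₗ-exchange (allSubsets v) (allSubsets v)
             (λ Y → 𝟙 (∣ Y ∣ ≟ y) * 𝟙 (X ⊆? Y)) (𝟙 ∘ InPart? z k) (λ Y Z → 𝟙 (Y ⊆? Z)) ⟩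
      ∑ˢ (λ Z → 𝟙 (InPart? z k Z) * intervalCount X y Z)
        ≡⟨ ∑ₗ-𝟙-*ʳ (allSubsets v) (InPart? z k)
             (λ Z (∣Z∣≡z , _) → intervalCount≡𝟙*C X Z ∣X∣≡x ∣Z∣≡z x≤y y≤z) ⟩
      ∑ˢ (λ Z → 𝟙 (InPart? z k Z) * 𝟙 (X ⊆? Z)) * c
        ≡⟨ cong (_* c) (R≡∑ˢ x≤z z≤v i k X∈i) ⟨
      R x z i k * c
        ≡⟨ *-comm (R x z i k) c ⟩
      c * R x z i k ∎
      where
      open ≡-Reasoning
      above : Subset v → ℕ
      above Y = ∑ˢ (λ Z → 𝟙 (InPart? z k Z) * 𝟙 (Y ⊆? Z))

    K-product : ∀ i k → ∑ (nParts y) (λ j → K x y i j * K y z j k) ≡ c * K x z i k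
    K-product i k with nonempty z z≤v k
    ... | Z , Z∈k@(∣Z∣≡z , _) = begin
      ∑ (nParts y) (λ j → K x y i j * K y z j k)
        ≡⟨ ∑-cong (nParts y) (λ j → trans (*-comm (K x y i j) _)
                                           (cong (_* K x y i j) (K≡∑ˢ y≤z z≤v j k Z∈k))) ⟩
      ∑ (nParts y) (λ j → ∑ˢ (λ Y → 𝟙 (InPart? y j Y) * 𝟙 (Y ⊆? Z)) * K x y i j)
        ≡⟨ ∑-over-parts 𝔓 y (K x y i) below (λ Y → 𝟙 (Y ⊆? Z))
             (λ j Y Y∈j → sym (K≡∑ˢ x≤y y≤v i j Y∈j)) ⟩
      ∑ˢ (λ Y → (𝟙 (∣ Y ∣ ≟ y) * 𝟙 (Y ⊆? Z)) * below Y)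
        ≡⟨ ∑ₗ-exchange (allSubsets v) (allSubsets v)
             (λ Y → 𝟙 (∣ Y ∣ ≟ y) * 𝟙 (Y ⊆? Z)) (𝟙 ∘ InPart? x i) (λ Y X → 𝟙 (X ⊆? Y)) ⟩
      ∑ˢ (λ X → 𝟙 (InPart? x i X) * ∑ˢ (λ Y → (𝟙 (∣ Y ∣ ≟ y) * 𝟙 (Y ⊆? Z)) * 𝟙 (X ⊆? Y)))
        ≡⟨ ∑ₗ-𝟙-*ʳ (allSubsets v) (InPart? x i) (λ X (∣X∣≡x , _) → trans
             (∑ₗ-cong (allSubsets v) (λ Y → xy∙z≈xz∙y (𝟙 (∣ Y ∣ ≟ y)) _ (𝟙 (X ⊆? Y))))
             (intervalCount≡𝟙*C X Z ∣X∣≡x ∣Z∣≡z x≤y y≤z)) ⟩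
      ∑ˢ (λ X → 𝟙 (InPart? x i X) * 𝟙 (X ⊆? Z)) * c
        ≡⟨ cong (_* c) (K≡∑ˢ x≤z z≤v i k Z∈k) ⟨
      K x z i k * c
        ≡⟨ *-comm (K x z i k) c ⟩
      c * K x z i k ∎
      where
      open ≡-Reasoning
      below : Subset v → ℕ
      below Y = ∑ˢ (λ X → 𝟙 (InPart? x i X) * 𝟙 (X ⊆? Y))

lemma3p3 : (v : ℕ) (𝔓 : PartitionSeq v) (T : Tactical 𝔓) (x y z : ℕ) →
    x ≤ y → y ≤ z → z ≤ v →
    ((i : Fin (PartitionSeq.nParts 𝔓 x)) (k : Fin (PartitionSeq.nParts 𝔓 z)) →
      ∑ (PartitionSeq.nParts 𝔓 y) (λ j → Tactical.R T x y i j * Tactical.R T y z j k)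
        ≡ ((z ∸ x) C (y ∸ x)) * Tactical.R T x z i k)
    × ((i : Fin (PartitionSeq.nParts 𝔓 x)) (k : Fin (PartitionSeq.nParts 𝔓 z)) →
      ∑ (PartitionSeq.nParts 𝔓 y) (λ j → Tactical.K T x y i j * Tactical.K T y z j k)
        ≡ ((z ∸ x) C (y ∸ x)) * Tactical.K T x z i k)
lemma3p3 v 𝔓 T x y z x≤y y≤z z≤v = R-product T x≤y y≤z z≤v , K-product T x≤y y≤z z≤v
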